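{- Let $a,d,n$ be positive integers. If $a\equiv -n\pmod{4dn-1}$, then, with $m=\frac{a+n}{4dn-1}$ and $M=\frac{4ad+1}{4dn-1}$ (both positive integers), one has $a\equiv -m\pmod{M}$. Conversely, if $m=\frac{a+n}{4dn-1}$ and $M=\frac{4ad+1}{4dn-1}$ are positive integers and $a\equiv -m\pmod M$, then $a\equiv -n\pmod{4dn-1}$. Moreover, both congruences give the same Type B solution for $a$: the solution $(duv,dua,dva)$ with $u=\frac{a+n}{4dn-1}$, $v=n$, and the solution $(du'v',du'a,dv'a)$ with $v'=m$, $u'=\frac{a+v'}{4dv'-1}$, satisfy $4dv'-1=M$ and $u'=n$, so they coincide up to the order of the coordinates.
   Context: A Type B solution for a positive integer $a$ is a triple $(duv,dua,dva)$ of positive integers with $\frac{4}{a}=\frac{1}{duv}+\frac{1}{dua}+\frac{1}{dva}$. -}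

module Defs where

open import Data.Nat using (ℕ; _+_; _*_; _<_)
open import Data.Product using (_×_; _,_)
open import Relation.Binary.PropositionalEquality using (_≡_)

-- A Type B solution for a : a triple (x , y , z) = (duv , dua , dva) of
-- positive integers with 4/a = 1/x + 1/y + 1/z.  For positive a, x, y, z
-- this rational equation is equivalent to the cross-multiplied identity
--   4 * x * y * z = a * (y*z + x*z + x*y).
TypeBSolution : ℕ → ℕ × ℕ × ℕ → Set
TypeBSolution a (x , y , z) =
  0 < x × 0 < y × 0 < z × 4 * (x * y * z) ≡ a * (y * z + x * z + x * y)

{-# OPTIONS --safe #-}
-- With K = 4dn - 1, the relation m K = a + n says exactly that 4dmn = a + m + n,
-- which is symmetric in m and n; hence n (4dm - 1) = a + m, the roles of (m, n)
-- and (n, m) are interchangeable, and (4dm - 1)(4dn - 1) = 4d(4dmn - m - n) + 1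
-- = 4ad + 1.  The symmetric relation is also what makes (dmn, dma, dna) a Type B
-- solution: 1/(dmn) + 1/(dma) + 1/(dna) = (a + m + n)/(dmna) = 4/a.
module Submission where

open import Defs
open import Data.Nat using (ℕ; zero; suc; _+_; _*_; _∸_; _<_; _≤_; z≤n; s≤s; >-nonZero)
open import Data.Nat.Properties
open import Data.Nat.Divisibility using (_∣_; divides)
open import Data.Nat.Tactic.RingSolver using (solve)
open import Data.Product using (_×_; _,_; ∃-syntax)
open import Data.List using (_∷_; [])
open import Data.List.Relation.Binary.Permutation.Propositional using (_↭_; prep; swap; ↭-refl)
open import Relation.Binary.PropositionalEquality using (_≡_; cong; cong₂; sym; trans)
open import Algebra.Properties.CommutativeSemigroup *-commutativeSemigroup
  using () renaming (xy∙z≈xz∙y to *-right-comm; xy∙z≈y∙xz to *-assoc-comm)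
open import Algebra.Properties.CommutativeSemigroup +-commutativeSemigroup
  using () renaming (xy∙z≈xz∙y to +-right-comm)

open Relation.Binary.PropositionalEquality.≡-Reasoning

m*[k∸1]≡x⇒m*k≡x+m : ∀ m {k x} → 0 < k → m * (k ∸ 1) ≡ x → m * k ≡ x + m
m*[k∸1]≡x⇒m*k≡x+m m {suc k} {x} _ eq = begin
  m * suc k  ≡⟨ *-suc m k ⟩
  m + m * k  ≡⟨ cong (m +_) eq ⟩
  m + x      ≡⟨ +-comm m x ⟩
  x + m      ∎

m*k≡x+m⇒m*[k∸1]≡x : ∀ m {k x} → 0 < k → m * k ≡ x + m → m * (k ∸ 1) ≡ x
m*k≡x+m⇒m*[k∸1]≡x m {suc k} {x} _ eq = +-cancelˡ-≡ m (m * k) x (begin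
  m + m * k  ≡⟨ *-suc m k ⟨
  m * suc k  ≡⟨ eq ⟩
  x + m      ≡⟨ +-comm x m ⟩
  m + x      ∎)

quotient-positive : ∀ {m k a n} → 0 < a → m * k ≡ a + n → 0 < m
quotient-positive {zero}  (s≤s z≤n) ()
quotient-positive {suc m} _         _ = s≤s z≤n

quotient⇒symmetric : ∀ c {a m n} → 0 < c * n → m * (c * n ∸ 1) ≡ a + n → c * m * n ≡ a + m + n
quotient⇒symmetric c {a} {m} {n} cn>0 eq = begin
  c * m * n    ≡⟨ *-assoc-comm c m n ⟩
  m * (c * n)  ≡⟨ m*[k∸1]≡x⇒m*k≡x+m m cn>0 eq ⟩
  a + n + m    ≡⟨ +-right-comm a n m ⟩
  a + m + n    ∎

symmetric-swap : ∀ c {a m n} → c * m * n ≡ a + m + n → c * n * m ≡ a + n + m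
symmetric-swap c {a} {m} {n} eq = begin
  c * n * m  ≡⟨ *-right-comm c n m ⟩
  c * m * n  ≡⟨ eq ⟩
  a + m + n  ≡⟨ +-right-comm a m n ⟩
  a + n + m  ∎

symmetric⇒quotient : ∀ c {a m n} → 0 < c * m → c * m * n ≡ a + m + n → n * (c * m ∸ 1) ≡ a + m
symmetric⇒quotient c {a} {m} {n} cm>0 eq =
  m*k≡x+m⇒m*[k∸1]≡x n cm>0 (trans (*-comm n (c * m)) eq)

modulus-product : ∀ c {a m n} → 0 < c * n → m * (c * n ∸ 1) ≡ a + n →
                  (c * m ∸ 1) * (c * n ∸ 1) ≡ c * a + 1
modulus-product c {a} {m} {n} cn>0 eq = begin
  (c * m ∸ 1) * K        ≡⟨ *-distribʳ-∸ K (c * m) 1 ⟩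
  c * m * K ∸ 1 * K      ≡⟨ cong₂ _∸_ (*-assoc c m K) (*-identityˡ K) ⟩
  c * (m * K) ∸ K        ≡⟨ cong (λ t → c * t ∸ K) eq ⟩
  c * (a + n) ∸ K        ≡⟨ cong (_∸ K) (*-distribˡ-+ c a n) ⟩
  c * a + c * n ∸ K      ≡⟨ +-∸-assoc (c * a) (m∸n≤m (c * n) 1) ⟩
  c * a + (c * n ∸ K)    ≡⟨ cong (c * a +_) (m∸[m∸n]≡n cn>0) ⟩
  c * a + 1              ∎
  where
  K : ℕ
  K = c * n ∸ 1

symmetric⇒TypeBSolution : ∀ {a d m n} → 0 < a → 0 < d → 0 < m → 0 < n →
                          4 * d * m * n ≡ a + m + n →
                          TypeBSolution a (d * m * n , d * m * a , d * n * a)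
symmetric⇒TypeBSolution {a} {d} {m} {n} a>0 d>0 m>0 n>0 eq =
  *-mono-≤ (*-mono-≤ d>0 m>0) n>0 , *-mono-≤ (*-mono-≤ d>0 m>0) a>0 ,
  *-mono-≤ (*-mono-≤ d>0 n>0) a>0 , (begin
    4 * (d * m * n * (d * m * a) * (d * n * a))    ≡⟨ solve (a ∷ d ∷ m ∷ n ∷ []) ⟩
    4 * d * m * n * (d * d * m * n * a * a)          ≡⟨ cong (_* (d * d * m * n * a * a)) eq ⟩
    (a + m + n) * (d * d * m * n * a * a)            ≡⟨ solve (a ∷ d ∷ m ∷ n ∷ []) ⟩
    a * (d * m * a * (d * n * a) + d * m * n * (d * n * a) + d * m * n * (d * m * a)) ∎)

4≤4*d*n : ∀ {d n} → 0 < d → 0 < n → 4 ≤ 4 * d * n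
4≤4*d*n d>0 n>0 = *-mono-≤ (*-mono-≤ (≤-refl {4}) d>0) n>0

0<4*d*n : ∀ {d n} → 0 < d → 0 < n → 0 < 4 * d * n
0<4*d*n d>0 n>0 = ≤-trans (s≤s z≤n) (4≤4*d*n d>0 n>0)

0<4*d*n∸1 : ∀ {d n} → 0 < d → 0 < n → 0 < 4 * d * n ∸ 1
0<4*d*n∸1 d>0 n>0 = m<n⇒0<n∸m (≤-trans (s≤s (s≤s z≤n)) (4≤4*d*n d>0 n>0))

proposition5 : (a d n : ℕ) → 0 < a → 0 < d → 0 < n →
  -- forward direction: a ≡ -n (mod 4dn-1) gives m, M positive integers with a ≡ -m (mod M)
  ((4 * d * n ∸ 1) ∣ a + n →
    ∃[ m ] ∃[ M ] (m * (4 * d * n ∸ 1) ≡ a + n × M * (4 * d * n ∸ 1) ≡ 4 * a * d + 1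
      × 0 < m × 0 < M × M ∣ a + m))
  -- converse direction
  × ((m M : ℕ) → m * (4 * d * n ∸ 1) ≡ a + n → M * (4 * d * n ∸ 1) ≡ 4 * a * d + 1 →
      0 < m → 0 < M → M ∣ a + m → (4 * d * n ∸ 1) ∣ a + n)
  -- both give the same Type B solution
  × ((m M : ℕ) → m * (4 * d * n ∸ 1) ≡ a + n → M * (4 * d * n ∸ 1) ≡ 4 * a * d + 1 →
      (4 * d * m ∸ 1 ≡ M)
      × (n * (4 * d * m ∸ 1) ≡ a + m)
      × ((u′ : ℕ) → u′ * (4 * d * m ∸ 1) ≡ a + m → u′ ≡ n)
      × TypeBSolution a (d * m * n , d * m * a , d * n * a)
      × TypeBSolution a (d * n * m , d * n * a , d * m * a)
      × ((d * m * n ∷ d * m * a ∷ d * n * a ∷ []) ↭ (d * n * m ∷ d * n * a ∷ d * m * a ∷ [])))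
proposition5 a d n a>0 d>0 n>0 =
    (λ { (divides m a+n≡m*K) →
           let m*K≡a+n = sym a+n≡m*K
           in m , 4 * d * m ∸ 1 , m*K≡a+n , modulus m*K≡a+n , positive m*K≡a+n
              , 0<4*d*n∸1 d>0 (positive m*K≡a+n) , divides n (sym (conjugate m*K≡a+n)) })
  , (λ m _ m*K≡a+n _ _ _ _ → divides m (sym m*K≡a+n))
  , λ m M m*K≡a+n M*K≡4ad+1 →
        *-cancelʳ-≡ _ M K {{>-nonZero K>0}} (trans (modulus m*K≡a+n) (sym M*K≡4ad+1))
      , conjugate m*K≡a+n
      , (λ u′ u′*L≡a+m → *-cancelʳ-≡ u′ n _ {{>-nonZero (0<4*d*n∸1 d>0 (positive m*K≡a+n))}}
                                       (trans u′*L≡a+m (sym (conjugate m*K≡a+n))))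
      , symmetric⇒TypeBSolution a>0 d>0 (positive m*K≡a+n) n>0 (symmetric m*K≡a+n)
      , symmetric⇒TypeBSolution a>0 d>0 n>0 (positive m*K≡a+n)
                                (symmetric-swap (4 * d) (symmetric m*K≡a+n))
      , same-entries m
  where
  K : ℕ
  K = 4 * d * n ∸ 1

  K>0 : 0 < K
  K>0 = 0<4*d*n∸1 d>0 n>0

  positive : ∀ {m} → m * K ≡ a + n → 0 < m
  positive = quotient-positive a>0

  symmetric : ∀ {m} → m * K ≡ a + n → 4 * d * m * n ≡ a + m + n
  symmetric = quotient⇒symmetric (4 * d) (0<4*d*n d>0 n>0)

  modulus : ∀ {m} → m * K ≡ a + n → (4 * d * m ∸ 1) * K ≡ 4 * a * d + 1
  modulus m*K≡a+n =
    trans (modulus-product (4 * d) (0<4*d*n d>0 n>0) m*K≡a+n) (cong (_+ 1) (*-right-comm 4 d a))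

  conjugate : ∀ {m} → m * K ≡ a + n → n * (4 * d * m ∸ 1) ≡ a + m
  conjugate m*K≡a+n =
    symmetric⇒quotient (4 * d) (0<4*d*n d>0 (positive m*K≡a+n)) (symmetric m*K≡a+n)

  same-entries : ∀ m → (d * m * n ∷ d * m * a ∷ d * n * a ∷ []) ↭ (d * n * m ∷ d * n * a ∷ d * m * a ∷ [])
  same-entries m rewrite *-right-comm d m n = prep _ (swap _ _ ↭-refl)
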